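{- Let $G$ be a unicyclic graph and let $v$ be a local maximum vertex of $G$. Let $G'$ be the unicyclic graph obtained from $G$ by transforming the pendant tree $T_v$ into a star with center $v$ (that is, all edges of $T_v$ are deleted and $v$ is joined to every other vertex of $T_v$, the rest of $G$ being unchanged). Then $GA(G')\le GA(G)$.
   Context: All graphs are finite and simple; $d_G(w)$ is the degree of $w$. A unicyclic graph is a connected graph with exactly one cycle. $GA(G)=\sum_{xy\in E(G)} \frac{2\sqrt{d_G(x)d_G(y)}}{d_G(x)+d_G(y)}$. A cycle vertex is a vertex on the cycle. A cycle vertex $v$ is a local maximum vertex if $d_G(v)\ge \max\{d_G(v_1),d_G(v_2)\}$, where $v_1,v_2$ are the two neighbors of $v$ on the cycle. For a cycle vertex $v$, the pendant tree $T_v$ rooted at $v$ is the maximal connected subgraph of $G$ containing $v$ and no other cycle vertex. -}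

module Defs where

open import Data.Bool using (Bool; true; false; _∧_; if_then_else_)
open import Data.Nat as ℕ using (ℕ; zero; suc; _+_; _*_; _≤ᵇ_; _<ᵇ_; _≡ᵇ_)
open import Data.Fin using (Fin; toℕ)
open import Data.List using (List; []; _∷_; length; filterᵇ; map; foldr; concatMap; allFin)
open import Data.Product using (Σ; _×_; _,_; ∃; ∃-syntax)
open import Data.Sum using (_⊎_)
open import Data.Unit using (⊤)
open import Data.Integer using (+_)
open import Data.Rational.Unnormalised using (ℚᵘ; _/_; 0ℚᵘ) renaming (_+_ to _+q_; _≤_ to _≤q_)
open import Relation.Binary.PropositionalEquality using (_≡_; _≢_)
open import Relation.Nullary using (¬_)
open import Function.Bundles using (_⇔_)

record Graph (n : ℕ) : Set where
  field
    adj   : Fin n → Fin n → Bool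
    sym   : ∀ a b → adj a b ≡ adj b a
    irrefl : ∀ a → adj a a ≡ false
open Graph public

countNbrs : ∀ {n} → (Fin n → Fin n → Bool) → Fin n → ℕ
countNbrs {n} R u = length (filterᵇ (R u) (allFin n))

deg : ∀ {n} → Graph n → Fin n → ℕ
deg G = countNbrs (adj G)

edges : ∀ {n} → Graph n → List (Fin n × Fin n)
edges {n} G =
  concatMap (λ i → map (λ j → (i , j))
                       (filterᵇ (λ j → adj G i j ∧ (toℕ i <ᵇ toℕ j)) (allFin n)))
            (allFin n)

-- Walks in a relation R whose entered vertices all satisfy P

data WalkIn {n} (R : Fin n → Fin n → Bool) (P : Fin n → Set) : Fin n → Fin n → Set where
  here : ∀ {a} → WalkIn R P a a
  step : ∀ {a c b} → R a c ≡ true → P c → WalkIn R P c b → WalkIn R P a b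

Connected : ∀ {n} → Graph n → Set
Connected G = ∀ a b → WalkIn (adj G) (λ _ → ⊤) a b

-- Cycles as subgraphs: a nonempty edge set C ⊆ E(G) which is
-- 2-regular on its vertices and connected (= a cycle of G).

IsCycle : ∀ {n} → Graph n → (Fin n → Fin n → Bool) → Set
IsCycle {n} G C =
    (∀ a b → C a b ≡ true → adj G a b ≡ true)
  × (∀ a b → C a b ≡ C b a)
  × (∃[ a ] ∃[ b ] (C a b ≡ true))
  × (∀ u → countNbrs C u ≡ 0 ⊎ countNbrs C u ≡ 2)
  × (∀ a b → countNbrs C a ≡ 2 → countNbrs C b ≡ 2 → WalkIn C (λ _ → ⊤) a b)

UnicyclicWith : ∀ {n} → Graph n → (Fin n → Fin n → Bool) → Set
UnicyclicWith {n} G C =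
    Connected G
  × IsCycle G C
  × (∀ C' → IsCycle G C' → ∀ a b → C' a b ≡ C a b)

CycleVertex : ∀ {n} → (Fin n → Fin n → Bool) → Fin n → Set
CycleVertex C u = countNbrs C u ≡ 2

LocalMax : ∀ {n} → Graph n → (Fin n → Fin n → Bool) → Fin n → Set
LocalMax G C v = CycleVertex C v × (∀ w → C v w ≡ true → deg G w ℕ.≤ deg G v)

-- vertex set of the pendant tree T_v: v and all vertices reachable from v
-- through non-cycle vertices only
InPendant : ∀ {n} → Graph n → (Fin n → Fin n → Bool) → Fin n → Fin n → Set
InPendant G C v w = WalkIn (adj G) (λ u → ¬ CycleVertex C u) v w

IsStarTransform : ∀ {n} → Graph n → (Fin n → Fin n → Bool) → Fin n → Graph n → Set
IsStarTransform G C v G' = ∀ a b →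
  (adj G' a b ≡ true) ⇔
    ((InPendant G C v a × InPendant G C v b × (a ≡ v ⊎ b ≡ v) × a ≢ b)
     ⊎ (¬ (InPendant G C v a × InPendant G C v b) × adj G a b ≡ true))

-- Geometric–arithmetic index, via exact rational bracketing.
-- Each edge xy contributes √(4 d(x) d(y)) / (d(x)+d(y)).

isqrt : ℕ → ℕ
isqrt zero = zero
isqrt (suc m) with isqrt m
... | k = if (suc k * suc k) ≤ᵇ suc m then suc k else k

-- ⌈√m⌉
csqrt : ℕ → ℕ
csqrt m with isqrt m
... | k = if (k * k) ≡ᵇ m then k else suc k

frac : ℕ → ℕ → ℚᵘ
frac a zero = 0ℚᵘ
frac a (suc d) = (+ a) / suc d

sumQ : List ℚᵘ → ℚᵘ
sumQ = foldr _+q_ 0ℚᵘ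

-- lower / upper approximations of GA(G) with precision 1/(N+1):
-- term = ⌊ or ⌈ √(4 d d' (N+1)²) ⌉ / ((N+1)(d + d'))
gaLower gaUpper : ∀ {n} → ℕ → Graph n → ℚᵘ
gaLower N G = sumQ (map (λ e → let x = deg G (Data.Product.proj₁ e); y = deg G (Data.Product.proj₂ e)
                               in frac (isqrt (4 * x * y * suc N * suc N)) (suc N * (x + y))) (edges G))
gaUpper N G = sumQ (map (λ e → let x = deg G (Data.Product.proj₁ e); y = deg G (Data.Product.proj₂ e)
                               in frac (csqrt (4 * x * y * suc N * suc N)) (suc N * (x + y))) (edges G))

-- GA(H) ≤ GA(G) as real numbers: for every precision, the lower bound
-- of GA(H) is at most the upper bound of GA(G).
GA≤ : ∀ {n} → Graph n → Graph n → Set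
GA≤ H G = ∀ N → gaLower N H ≤q gaUpper N G

{-# OPTIONS --safe #-}
-- The GA weight 2√(xy)/(x+y) of an edge depends only on the ratio of the end degrees x, y
-- and decreases as that ratio moves away from 1.  We inject E(G′) into E(G) so that no edge
-- weight increases.  Unicyclicity gives that T_v meets the rest of G only in v: an edge from
-- T_v to another cycle vertex would close a second cycle.  Hence an edge of G′ outside T_v
-- is an edge of G with the same end degrees, except that the degree of v grows to
-- D = deg_{G′} v; then the other end w is a cycle neighbour of v, so deg w ≤ deg v ≤ D by
-- local maximality and the weight only drops.  A star edge vu of G′ has weight 2√D/(D+1);
-- it is sent to the edge joining u to its parent in a breadth-first search of T_v from v,
-- which makes the map injective, and since all degrees in T_v lie between 1 and D that edge
-- weighs at least 2√D/(D+1).  The comparison is made termwise on the rational brackets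
-- that define GA≤.
module Submission where

open import Defs hiding (sym)
open import Data.Bool using (Bool; true; false; _∧_; T)
open import Data.Bool.Properties using (T-≡; T-∧) renaming (_≟_ to _≟ᵇ_)
open import Data.Empty using (⊥; ⊥-elim)
open import Data.Fin using (Fin; toℕ)
open import Data.Fin.Properties using (_≟_; _<?_; <-cmp; <-asym; any?)
open import Data.Fin.Permutation.Components using (transpose; transpose-inverse)
open import Data.Integer using (+≤+) renaming (_≤_ to _≤ℤ_)
import Data.Integer.Properties as ℤ
open import Data.List using (List; []; _∷_; _++_; length; map; filterᵇ; allFin)
open import Data.List.Membership.Propositional using (_∈_)
import Data.List.Membership.DecPropositional as DecMembership
open import Data.List.Membership.Propositional.Properties
  using (∈-allFin; ∈-filter⁺; ∈-filter⁻; ∈-map⁻; ∈-concatMap⁻; ∈-concatMap⁺; ∈-map∘filter⁻; ∈-map∘filter⁺)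
open import Data.List.Membership.Propositional.Properties.WithK using (unique∧set⇒bag)
open import Data.List.Properties using (length-filter; length-map; length-++)
open import Data.List.Relation.Binary.BagAndSetEquality using (∼bag⇒↭)
open import Data.List.Relation.Binary.Permutation.Propositional.Properties using (↭-length)
open import Data.List.Relation.Unary.All as All using (All; []; _∷_)
open import Data.List.Relation.Unary.All.Properties using (¬Any⇒All¬) renaming (map⁺ to All-map⁺)
import Data.List.Relation.Unary.AllPairs as AllPairs
open import Data.List.Relation.Unary.AllPairs using ([]; _∷_)
open import Data.List.Relation.Unary.AllPairs.Properties using () renaming (map⁺ to AllPairs-map⁺)
open import Data.List.Relation.Unary.Any as Any using (here; there; _─_)
open import Data.List.Relation.Unary.Unique.Propositional using (Unique)
import Data.List.Relation.Unary.Unique.Propositional.Properties as Unique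
open import Data.Nat as ℕ using (ℕ; zero; suc; _+_; _*_; _≤_; _<_; z≤n; s≤s; _≤ᵇ_; _≡ᵇ_; _<ᵇ_; >-nonZero)
open import Data.Nat.Properties
  using ( ≤-refl; ≤-reflexive; ≤-trans; ≤-total; <⇒≤; <-irrefl; <-≤-trans; ≮⇒≥; <⇒≱; ≰⇒>; n≤1+n; m≤n⇒m≤1+n
        ; n<1+n; m≤n⇒m<n∨m≡n; m≤m+n; m≤n*m; m≤n⇒∃[o]m+o≡n; +-comm; +-mono-≤; *-mono-<; *-monoˡ-≤; *-monoʳ-≤
        ; ≤ᵇ⇒≤; ≤⇒≤ᵇ; ≡ᵇ⇒≡; <ᵇ⇒<; <⇒<ᵇ; anyUpTo?; module ≤-Reasoning)
open import Data.Nat.Tactic.RingSolver using (solve-∀)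
open import Data.Product using (Σ; ∃; _×_; _,_; proj₁; proj₂)
open import Data.Rational.Unnormalised using (ℚᵘ; 0ℚᵘ; *≤*) renaming (_≤_ to _≤q_; _+_ to _+q_)
import Data.Rational.Unnormalised.Properties as ℚᵘ
open import Data.Sum using (_⊎_; inj₁; inj₂; swap)
open import Data.Unit using (⊤; tt)
open import Function.Base using (_∘_; id)
open import Function.Bundles using (Equivalence; mk⇔)
open import Function.Definitions using (Injective)
open import Relation.Binary.Definitions using (DecidableEquality; tri<; tri≈; tri>)
open import Relation.Binary.PropositionalEquality
open import Relation.Nullary using (Dec; yes; no; does; ¬_; ¬?; _×-dec_; _⊎-dec_)
open import Relation.Nullary.Decidable using (T?; map′; dec-true; dec-false; does-⇔)

-- Bracketed GA weights

isqrt-bounds : ∀ m → isqrt m * isqrt m ≤ m × m < suc (isqrt m) * suc (isqrt m)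
isqrt-bounds zero = z≤n , s≤s z≤n
isqrt-bounds (suc m) with isqrt m | isqrt-bounds m
... | k | k²≤m , m<[1+k]² with suc k * suc k ≤ᵇ suc m in eq
... | true  = ≤ᵇ⇒≤ _ _ (Equivalence.from T-≡ eq)
            , <-≤-trans (s≤s m<[1+k]²) (*-mono-< (n<1+n (suc k)) (n<1+n (suc k)))
... | false = m≤n⇒m≤1+n k²≤m , ≰⇒> (λ le → subst T eq (≤⇒≤ᵇ le))

csqrt-bound : ∀ m → m ≤ csqrt m * csqrt m
csqrt-bound m with isqrt m | isqrt-bounds m
... | k | _ , m<[1+k]² with k * k ≡ᵇ m in eq
... | true  = ≤-reflexive (sym (≡ᵇ⇒≡ _ _ (Equivalence.from T-≡ eq)))
... | false = <⇒≤ m<[1+k]²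

frac-≤ : ∀ a b s′ s → 1 ≤ s → a * s ≤ b * s′ → frac a s′ ≤q frac b s
frac-≤ a b zero    (suc d) _ _ = *≤* (subst₂ _≤ℤ_ (ℤ.pos-* 0 (suc d)) (ℤ.pos-* b 1) (+≤+ z≤n))
frac-≤ a b (suc d′) (suc d) _ h = *≤* (subst₂ _≤ℤ_ (ℤ.pos-* a (suc d)) (ℤ.pos-* b (suc d′)) (+≤+ h))

0≤frac : ∀ b s → 0ℚᵘ ≤q frac b s
0≤frac b zero    = ℚᵘ.≤-refl
0≤frac b (suc d) = frac-≤ 0 b zero (suc d) (s≤s z≤n) z≤n

lowerTerm upperTerm : ℕ → ℕ → ℕ → ℚᵘ
lowerTerm N x y = frac (isqrt (4 * x * y * suc N * suc N)) (suc N * (x + y))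
upperTerm N x y = frac (csqrt (4 * x * y * suc N * suc N)) (suc N * (x + y))

4xy≡4yx : ∀ x y → 4 * x * y ≡ 4 * y * x
4xy≡4yx = solve-∀

lowerTerm-comm : ∀ N x y → lowerTerm N x y ≡ lowerTerm N y x
lowerTerm-comm N x y =
  cong₂ frac (cong (λ z → isqrt (z * suc N * suc N)) (4xy≡4yx x y)) (cong (suc N *_) (+-comm x y))

upperTerm-comm : ∀ N x y → upperTerm N x y ≡ upperTerm N y x
upperTerm-comm N x y =
  cong₂ frac (cong (λ z → csqrt (z * suc N * suc N)) (4xy≡4yx x y)) (cong (suc N *_) (+-comm x y))

-- (x′ , y′) ≤ʷ (x , y) says 4x′y′/(x′+y′)² ≤ 4xy/(x+y)², i.e. that the GA weight
-- 2√(x′y′)/(x′+y′) of an edge with end degrees x′, y′ is at most that of x, y.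
_≤ʷ_ : ℕ × ℕ → ℕ × ℕ → Set
(x′ , y′) ≤ʷ (x , y) = x′ * y′ * ((x + y) * (x + y)) ≤ x * y * ((x′ + y′) * (x′ + y′))

lowerTerm≤upperTerm : ∀ N x′ y′ x y → 1 ≤ x + y → (x′ , y′) ≤ʷ (x , y)
                    → lowerTerm N x′ y′ ≤q upperTerm N x y
lowerTerm≤upperTerm N x′ y′ x y 1≤x+y w =
  frac-≤ a b s′ s (≤-trans 1≤x+y (m≤n*m (x + y) M)) (*-cancel-≤ square-≤)
  where
  M = suc N
  A = 4 * x′ * y′ * M * M
  B = 4 * x * y * M * M
  a = isqrt A
  b = csqrt B
  s = M * (x + y)
  s′ = M * (x′ + y′)
  *-cancel-≤ : ∀ {p q} → p * p ≤ q * q → p ≤ q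
  *-cancel-≤ {p} {q} h = ≮⇒≥ (λ q<p → <⇒≱ (*-mono-< q<p q<p) h)
  [pq]²≡p²q² : ∀ p q → (p * q) * (p * q) ≡ (p * p) * (q * q)
  [pq]²≡p²q² = solve-∀
  rearrange : ∀ x y x′ y′ M → 4 * x * y * M * M * ((M * (x′ + y′)) * (M * (x′ + y′)))
                            ≡ (4 * M * M * M * M) * (x * y * ((x′ + y′) * (x′ + y′)))
  rearrange = solve-∀
  open ≤-Reasoning
  square-≤ : (a * s) * (a * s) ≤ (b * s′) * (b * s′)
  square-≤ = begin
    (a * s) * (a * s)                      ≡⟨ [pq]²≡p²q² a s ⟩
    (a * a) * (s * s)                      ≤⟨ *-monoˡ-≤ (s * s) (proj₁ (isqrt-bounds A)) ⟩
    A * (s * s)                            ≡⟨ rearrange x′ y′ x y M ⟩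
    (4 * M * M * M * M) * (x′ * y′ * ((x + y) * (x + y)))
                                           ≤⟨ *-monoʳ-≤ (4 * M * M * M * M) w ⟩
    (4 * M * M * M * M) * (x * y * ((x′ + y′) * (x′ + y′)))
                                           ≡⟨ rearrange x y x′ y′ M ⟨
    B * (s′ * s′)                          ≤⟨ *-monoˡ-≤ (s′ * s′) (csqrt-bound B) ⟩
    (b * b) * (s′ * s′)                    ≡⟨ [pq]²≡p²q² b s′ ⟨
    (b * s′) * (b * s′)                    ∎

-- x y (D + 1)² − D (x + y)² = (x D − y) (y D − x), and both factors are nonnegative.
star≤ʷ : ∀ {D x y} → 1 ≤ x → 1 ≤ y → x ≤ D → y ≤ D → (D , 1) ≤ʷ (x , y)
star≤ʷ {D} {x} {y} 1≤x 1≤y x≤D y≤D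
  with a , y+a≡xD ← m≤n⇒∃[o]m+o≡n (≤-trans y≤D (m≤n*m D x ⦃ >-nonZero 1≤x ⦄))
     | b , x+b≡yD ← m≤n⇒∃[o]m+o≡n (≤-trans x≤D (m≤n*m D y ⦃ >-nonZero 1≤y ⦄)) = begin
  D * 1 * ((x + y) * (x + y))                      ≡⟨ expand-left x y D ⟩
  x * (x * D) + y * (y * D) + 2 * P                ≡⟨ cong₂ (λ p q → x * p + y * q + 2 * P) y+a≡xD x+b≡yD ⟨
  x * (y + a) + y * (x + b) + 2 * P                ≤⟨ m≤m+n _ (a * b) ⟩
  x * (y + a) + y * (x + b) + 2 * P + a * b        ≡⟨ regroup x y a b P ⟩
  (y + a) * (x + b) + 2 * P + x * y                ≡⟨ cong₂ (λ p q → p * q + 2 * P + x * y) y+a≡xD x+b≡yD ⟩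
  (x * D) * (y * D) + 2 * P + x * y                ≡⟨ expand-right x y D ⟩
  x * y * ((D + 1) * (D + 1))                      ∎
  where
  open ≤-Reasoning
  P = x * (y * D)
  expand-left : ∀ x y D → D * 1 * ((x + y) * (x + y)) ≡ x * (x * D) + y * (y * D) + 2 * (x * (y * D))
  expand-left = solve-∀
  regroup : ∀ x y a b P → x * (y + a) + y * (x + b) + 2 * P + a * b ≡ (y + a) * (x + b) + 2 * P + x * y
  regroup = solve-∀
  expand-right : ∀ x y D → (x * D) * (y * D) + 2 * (x * (y * D)) + x * y ≡ x * y * ((D + 1) * (D + 1))
  expand-right = solve-∀

-- d y (D + y)² − D y (d + y)² = y (D − d) (d D − y²).
grow≤ʷ : ∀ {y d D} → y ≤ d → d ≤ D → (D , y) ≤ʷ (d , y)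
grow≤ʷ {y} y≤d d≤D with g , refl ← m≤n⇒∃[o]m+o≡n y≤d | e , refl ← m≤n⇒∃[o]m+o≡n d≤D =
  ≤-trans (m≤m+n _ _) (≤-reflexive (difference y g e))
  where
  difference : ∀ y g e → (y + g + e) * y * ((y + g + y) * (y + g + y))
                         + y * e * (2 * y * g + g * g + y * e + g * e)
                       ≡ (y + g) * y * ((y + g + e + y) * (y + g + e + y))
  difference = solve-∀

0≤upperTerm : ∀ N x y → 0ℚᵘ ≤q upperTerm N x y
0≤upperTerm N x y = 0≤frac (csqrt (4 * x * y * suc N * suc N)) (suc N * (x + y))

-- Sums and neighbour counts

module _ {A : Set} (h : A → ℚᵘ) where

  sumQ-─ : ∀ {y} ys (y∈ys : y ∈ ys) → sumQ (map h ys) ≡ h y +q sumQ (map h (ys ─ y∈ys))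
  sumQ-─ (_ ∷ ys) (here refl) = refl
  sumQ-─ {y} (z ∷ ys) (there y∈ys) = begin
    h z +q sumQ (map h ys)  ≡⟨ cong (h z +q_) (sumQ-─ ys y∈ys) ⟩
    h z +q (h y +q rest)    ≡⟨ ℚᵘ.+-assoc-≡ (h z) (h y) rest ⟨
    (h z +q h y) +q rest    ≡⟨ cong (_+q rest) (ℚᵘ.+-comm-≡ (h z) (h y)) ⟩
    (h y +q h z) +q rest    ≡⟨ ℚᵘ.+-assoc-≡ (h y) (h z) rest ⟩
    h y +q (h z +q rest)    ∎
    where
    open ≡-Reasoning
    rest = sumQ (map h (ys ─ y∈ys))

  0≤sumQ : (∀ y → 0ℚᵘ ≤q h y) → ∀ ys → 0ℚᵘ ≤q sumQ (map h ys)
  0≤sumQ 0≤h []       = ℚᵘ.≤-refl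
  0≤sumQ 0≤h (y ∷ ys) = subst (_≤q h y +q sumQ (map h ys)) (ℚᵘ.+-identityˡ-≡ 0ℚᵘ)
                              (ℚᵘ.+-mono-≤ (0≤h y) (0≤sumQ 0≤h ys))

∈-─ : ∀ {A : Set} {y z : A} ys (y∈ys : y ∈ ys) → z ∈ ys → z ≢ y → z ∈ (ys ─ y∈ys)
∈-─ (_ ∷ ys) (here refl)  (here refl)  z≢y = ⊥-elim (z≢y refl)
∈-─ (_ ∷ ys) (here refl)  (there z∈ys) z≢y = z∈ys
∈-─ (_ ∷ ys) (there y∈ys) (here refl)  z≢y = here refl
∈-─ (_ ∷ ys) (there y∈ys) (there z∈ys) z≢y = there (∈-─ ys y∈ys z∈ys z≢y)

sumQ-≤-injection : ∀ {A : Set} (g h : A → ℚᵘ) → (∀ y → 0ℚᵘ ≤q h y) → ∀ {xs ys} → Unique xs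
                 → (f : ∀ {x} → x ∈ xs → A) → (∀ {x} (x∈xs : x ∈ xs) → f x∈xs ∈ ys)
                 → (∀ {x x′} (x∈xs : x ∈ xs) (x′∈xs : x′ ∈ xs) → f x∈xs ≡ f x′∈xs → x ≡ x′)
                 → (∀ {x} (x∈xs : x ∈ xs) → g x ≤q h (f x∈xs))
                 → sumQ (map g xs) ≤q sumQ (map h ys)
sumQ-≤-injection g h 0≤h {[]} {ys} _ _ _ _ _ = 0≤sumQ h 0≤h ys
sumQ-≤-injection g h 0≤h {x ∷ xs} {ys} (x∉xs ∷ uxs) f f∈ys f-inj g≤hf =
  subst (g x +q sumQ (map g xs) ≤q_) (sym (sumQ-─ h ys fx∈ys))
    (ℚᵘ.+-mono-≤ (g≤hf (here refl))
      (sumQ-≤-injection g h 0≤h uxs (λ z∈xs → f (there z∈xs)) f∈rest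
        (λ p p′ → f-inj (there p) (there p′)) (λ z∈xs → g≤hf (there z∈xs))))
  where
  fx∈ys = f∈ys (here refl)
  f∈rest : ∀ {z} (z∈xs : z ∈ xs) → f (there z∈xs) ∈ (ys ─ fx∈ys)
  f∈rest z∈xs = ∈-─ ys fx∈ys (f∈ys (there z∈xs))
                  (λ e → All.lookup x∉xs z∈xs (sym (f-inj (there z∈xs) (here refl) e)))

module _ {A : Set} where

  unique-length-≡ : ∀ {xs ys : List A} → Unique xs → Unique ys
                  → (∀ {z} → z ∈ xs → z ∈ ys) → (∀ {z} → z ∈ ys → z ∈ xs) → length xs ≡ length ys
  unique-length-≡ uxs uys to from = ↭-length (∼bag⇒↭ (unique∧set⇒bag uxs uys (mk⇔ to from)))

  unique-length-≤ : ∀ {xs ys : List A} → DecidableEquality A → Unique xs → Unique ys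
                  → (∀ {z} → z ∈ xs → z ∈ ys) → length xs ≤ length ys
  unique-length-≤ {xs} {ys} _≟_ uxs uys xs⊆ys = ≤-trans
    (≤-reflexive (unique-length-≡ uxs (Unique.filter⁺ (_∈? xs) {ys} uys)
                   (λ z∈xs → ∈-filter⁺ (_∈? xs) (xs⊆ys z∈xs) z∈xs)
                   (proj₂ ∘ ∈-filter⁻ (_∈? xs) {xs = ys})))
    (length-filter (_∈? xs) ys)
    where open DecMembership _≟_ using (_∈?_)

module _ {n : ℕ} where

  nbrs : (Fin n → Fin n → Bool) → Fin n → List (Fin n)
  nbrs R a = filterᵇ (R a) (allFin n)

  ∈-nbrs⁺ : ∀ {R a w} → R a w ≡ true → w ∈ nbrs R a
  ∈-nbrs⁺ {R} {a} {w} Raw = ∈-filter⁺ (T? ∘ R a) (∈-allFin w) (Equivalence.from T-≡ Raw)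

  ∈-nbrs⁻ : ∀ {R a w} → w ∈ nbrs R a → R a w ≡ true
  ∈-nbrs⁻ {R} {a} w∈ = Equivalence.to T-≡ (proj₂ (∈-filter⁻ (T? ∘ R a) {xs = allFin n} w∈))

  nbrs-unique : ∀ {R a} → Unique (nbrs R a)
  nbrs-unique {R} {a} = Unique.filter⁺ (T? ∘ R a) (Unique.allFin⁺ n)

  countNbrs≡length : ∀ {R a ys} → Unique ys → (∀ {w} → R a w ≡ true → w ∈ ys)
                   → (∀ {w} → w ∈ ys → R a w ≡ true) → countNbrs R a ≡ length ys
  countNbrs≡length {R} {a} uys to from =
    unique-length-≡ (nbrs-unique {R} {a}) uys (to ∘ ∈-nbrs⁻ {R} {a}) (∈-nbrs⁺ {R} {a} ∘ from)

  countNbrs-≤ : ∀ {R a S b} {f : Fin n → Fin n} → Injective _≡_ _≡_ f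
              → (∀ {w} → R a w ≡ true → S b (f w) ≡ true) → countNbrs R a ≤ countNbrs S b
  countNbrs-≤ {R} {a} {S} {b} {f} f-inj R⇒S = ≤-trans
    (≤-reflexive (sym (length-map f (nbrs R a))))
    (unique-length-≤ _≟_ (Unique.map⁺ f-inj (nbrs-unique {R} {a})) (nbrs-unique {S} {b}) mapped⊆)
    where
    mapped⊆ : ∀ {z} → z ∈ map f (nbrs R a) → z ∈ nbrs S b
    mapped⊆ z∈ with w , w∈ , refl ← ∈-map⁻ f z∈ = ∈-nbrs⁺ {S} {b} (R⇒S (∈-nbrs⁻ {R} {a} w∈))

  0<countNbrs : ∀ {R a w} → R a w ≡ true → 0 < countNbrs R a
  0<countNbrs {R} {a} Raw =
    unique-length-≤ _≟_ ([] ∷ []) (nbrs-unique {R} {a}) (λ { (here refl) → ∈-nbrs⁺ {R} {a} Raw })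

  nbr-witness : ∀ {R a} → 0 < countNbrs R a → ∃ λ w → R a w ≡ true
  nbr-witness {R} {a} pos with nbrs R a | ∈-nbrs⁻ {R} {a}
  ... | w ∷ _ | ∈⇒R = w , ∈⇒R (here refl)

module _ {n : ℕ} where

  transpose-≡ : ∀ (i j : Fin n) → transpose i j i ≡ j
  transpose-≡ i j rewrite dec-true (i ≟ i) refl = refl

  transpose-≢ : ∀ {i j k : Fin n} → k ≢ i → k ≢ j → transpose i j k ≡ k
  transpose-≢ {i} {j} {k} k≢i k≢j rewrite dec-false (k ≟ i) k≢i | dec-false (k ≟ j) k≢j = refl

  transpose-injective : ∀ (i j : Fin n) {k k′} → transpose i j k ≡ transpose i j k′ → k ≡ k′
  transpose-injective i j {k} {k′} e =
    trans (sym (transpose-inverse j i)) (trans (cong (transpose j i) e) (transpose-inverse j i))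

-- Edge lists

module _ {n : ℕ} (G : Graph n) where

  adj⇒≢ : ∀ {a b} → adj G a b ≡ true → a ≢ b
  adj⇒≢ {a} Gab refl with () ← trans (sym (irrefl G a)) Gab

  0<deg : ∀ {a b} → adj G a b ≡ true → 0 < deg G a
  0<deg {a} = 0<countNbrs {R = adj G} {a = a}

  0<deg+deg : ∀ {a b} → adj G a b ≡ true → 0 < deg G a + deg G b
  0<deg+deg Gab = ≤-trans (0<deg Gab) (m≤m+n _ _)

  private
    row : Fin n → List (Fin n × Fin n)
    row i = map (i ,_) (filterᵇ (λ j → adj G i j ∧ (toℕ i <ᵇ toℕ j)) (allFin n))

  ∈-edges⁻ : ∀ {a b} → (a , b) ∈ edges G → adj G a b ≡ true × toℕ a < toℕ b
  ∈-edges⁻ ab∈ with Any.satisfied (∈-concatMap⁻ row {xs = allFin n} ab∈)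
  ... | i , ab∈row with ∈-map∘filter⁻ (i ,_) (λ j → T? (adj G i j ∧ (toℕ i <ᵇ toℕ j))) {xs = allFin n}
                                      ab∈row
  ... | _ , _ , refl , t with Gab , a<ᵇb ← Equivalence.to T-∧ t = Equivalence.to T-≡ Gab , <ᵇ⇒< _ _ a<ᵇb

  ∈-edges⁺ : ∀ {a b} → adj G a b ≡ true → toℕ a < toℕ b → (a , b) ∈ edges G
  ∈-edges⁺ {a} {b} Gab a<b = ∈-concatMap⁺ row {xs = allFin n} (Any.map (λ { refl → ab∈row }) (∈-allFin a))
    where
    ab∈row : (a , b) ∈ row a
    ab∈row = ∈-map∘filter⁺ (a ,_) (λ j → T? (adj G a j ∧ (toℕ a <ᵇ toℕ j)))
               (b , ∈-allFin b , refl , Equivalence.from T-∧ (Equivalence.from T-≡ Gab , <⇒<ᵇ a<b))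

  edges-unique : Unique (edges G)
  edges-unique = Unique.concat⁺
    (All-map⁺ (All.tabulate (λ _ → Unique.map⁺ (λ { refl → refl }) (Unique.filter⁺ _ (Unique.allFin⁺ n)))))
    (AllPairs-map⁺ (AllPairs.map (λ i≢j {e} (e∈i , e∈j) → i≢j (trans (sym (row-fst e∈i)) (row-fst e∈j)))
                                  (Unique.allFin⁺ n)))
    where
    row-fst : ∀ {i e} → e ∈ row i → proj₁ e ≡ i
    row-fst {i} e∈ with _ , _ , refl ← ∈-map⁻ (i ,_) e∈ = refl

module _ {n : ℕ} where

  edgeOf : Fin n → Fin n → Fin n × Fin n
  edgeOf a b with a <? b
  ... | yes _ = a , b
  ... | no _  = b , a

  edgeOf-< : ∀ {a b} → toℕ a < toℕ b → edgeOf a b ≡ (a , b)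
  edgeOf-< {a} {b} a<b with a <? b
  ... | yes _  = refl
  ... | no a≮b = ⊥-elim (a≮b a<b)

  edgeOf-> : ∀ {a b} → toℕ b < toℕ a → edgeOf a b ≡ (b , a)
  edgeOf-> {a} {b} b<a with a <? b
  ... | yes a<b = ⊥-elim (<-asym a<b b<a)
  ... | no _    = refl

  edgeOf-cases : ∀ a b → edgeOf a b ≡ (a , b) ⊎ edgeOf a b ≡ (b , a)
  edgeOf-cases a b with a <? b
  ... | yes _ = inj₁ refl
  ... | no _  = inj₂ refl

  edgeOf-∈ : ∀ (G : Graph n) {a b} → adj G a b ≡ true → edgeOf a b ∈ edges G
  edgeOf-∈ G {a} {b} Gab with <-cmp a b
  ... | tri< a<b _ _ rewrite edgeOf-< a<b = ∈-edges⁺ G Gab a<b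
  ... | tri≈ _ a≡b _ = ⊥-elim (adj⇒≢ G Gab a≡b)
  ... | tri> _ _ b<a rewrite edgeOf-> b<a = ∈-edges⁺ G (trans (Graph.sym G b a) Gab) b<a

  edgeOf-endpoints : ∀ {a b c d} → edgeOf a b ≡ (c , d) → (a ≡ c × b ≡ d) ⊎ (a ≡ d × b ≡ c)
  edgeOf-endpoints {a} {b} e with edgeOf-cases a b
  ... | inj₁ ab rewrite ab with refl ← e = inj₁ (refl , refl)
  ... | inj₂ ba rewrite ba with refl ← e = inj₂ (refl , refl)

  edgeOf-injective : ∀ {a b c d} → edgeOf a b ≡ edgeOf c d → (a ≡ c × b ≡ d) ⊎ (a ≡ d × b ≡ c)
  edgeOf-injective {a} {b} {c} {d} e with edgeOf-cases c d
  ... | inj₁ cd = edgeOf-endpoints (trans e cd)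
  ... | inj₂ dc = swap (edgeOf-endpoints (trans e dc))

module _ {n : ℕ} where

  lowerTermOf upperTermOf : ℕ → Graph n → Fin n × Fin n → ℚᵘ
  lowerTermOf N H (a , b) = lowerTerm N (deg H a) (deg H b)
  upperTermOf N H (a , b) = upperTerm N (deg H a) (deg H b)

  upperTermOf-edgeOf : ∀ N H a b → upperTermOf N H (edgeOf a b) ≡ upperTerm N (deg H a) (deg H b)
  upperTermOf-edgeOf N H a b with edgeOf-cases a b
  ... | inj₁ ab rewrite ab = refl
  ... | inj₂ ba rewrite ba = upperTerm-comm N (deg H b) (deg H a)

  lowerTermOf-edgeOf : ∀ N H a b → lowerTermOf N H (edgeOf a b) ≡ lowerTerm N (deg H a) (deg H b)
  lowerTermOf-edgeOf N H a b with edgeOf-cases a b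
  ... | inj₁ ab rewrite ab = refl
  ... | inj₂ ba rewrite ba = lowerTerm-comm N (deg H b) (deg H a)

-- Walks

module _ {n : ℕ} {R : Fin n → Fin n → Bool} {Q : Fin n → Set} where

  visited : ∀ {a b} → WalkIn R Q a b → List (Fin n)
  visited here                 = []
  visited (step {c = c} _ _ W) = c ∷ visited W

  snoc : ∀ {a b c} → WalkIn R Q a b → R b c ≡ true → Q c → WalkIn R Q a c
  snoc here         Rbc Qc = step Rbc Qc here
  snoc (step r q W) Rbc Qc = step r q (snoc W Rbc Qc)

  infixr 5 _++ʷ_
  _++ʷ_ : ∀ {a b c} → WalkIn R Q a b → WalkIn R Q b c → WalkIn R Q a c
  here       ++ʷ W′ = W′
  step r q W ++ʷ W′ = step r q (W ++ʷ W′)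

  visited-++ʷ : ∀ {a b c} (W : WalkIn R Q a b) (W′ : WalkIn R Q b c)
              → visited (W ++ʷ W′) ≡ visited W ++ visited W′
  visited-++ʷ here         W′ = refl
  visited-++ʷ (step r q W) W′ = cong (_ ∷_) (visited-++ʷ W W′)

  end-in-Q : ∀ {a b} → WalkIn R Q a b → a ≡ b ⊎ Q b
  end-in-Q here = inj₁ refl
  end-in-Q (step r q W) with end-in-Q W
  ... | inj₁ refl = inj₂ q
  ... | inj₂ Qb   = inj₂ Qb

  All-visited : ∀ {P : Fin n → Set} → (∀ {x y} → R x y ≡ true → Q y → P y)
              → ∀ {a b} (W : WalkIn R Q a b) → All P (visited W)
  All-visited R∧Q⇒P here         = []
  All-visited R∧Q⇒P (step r q W) = R∧Q⇒P r q ∷ All-visited R∧Q⇒P W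

  -- vertexAt W 0 is the start of W; indices past its end give junk.
  vertexAt : ∀ {a b} → WalkIn R Q a b → ℕ → Fin n
  vertexAt {a} _            zero    = a
  vertexAt {a} here         (suc i) = a
  vertexAt     (step r q W) (suc i) = vertexAt W i

  vertexAt-end : ∀ {a b} (W : WalkIn R Q a b) → vertexAt W (length (visited W)) ≡ b
  vertexAt-end here         = refl
  vertexAt-end (step r q W) = vertexAt-end W

  vertexAt-step : ∀ {a b} (W : WalkIn R Q a b) {i} → i < length (visited W)
                → R (vertexAt W i) (vertexAt W (suc i)) ≡ true
  vertexAt-step (step r q W)              {zero}  _        = r
  vertexAt-step (step r q (step r′ q′ W)) {suc i} (s≤s i<) = vertexAt-step (step r′ q′ W) i<

  vertexAt-∈ : ∀ {a b} (W : WalkIn R Q a b) {i} → i ≤ length (visited W) → vertexAt W i ∈ a ∷ visited W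
  vertexAt-∈ W            {zero}  _        = here refl
  vertexAt-∈ (step r q W) {suc i} (s≤s i≤) = there (vertexAt-∈ W i≤)

  vertexAt-injective : ∀ {a b} (W : WalkIn R Q a b) → Unique (a ∷ visited W) → ∀ {i j}
                     → i ≤ length (visited W) → j ≤ length (visited W) → vertexAt W i ≡ vertexAt W j → i ≡ j
  vertexAt-injective W            _            {zero}  {zero}  _ _ _ = refl
  vertexAt-injective (step r q W) (a∉ ∷ _)     {zero}  {suc j} _ (s≤s j≤) e =
    ⊥-elim (All.lookup a∉ (vertexAt-∈ W j≤) e)
  vertexAt-injective (step r q W) (a∉ ∷ _)     {suc i} {zero}  (s≤s i≤) _ e =
    ⊥-elim (All.lookup a∉ (vertexAt-∈ W i≤) (sym e))
  vertexAt-injective (step r q W) (_ ∷ unique) {suc i} {suc j} (s≤s i≤) (s≤s j≤) e =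
    cong suc (vertexAt-injective W unique i≤ j≤ e)

  private
    open DecMembership (_≟_ {n}) using (_∈?_)

    suffixFrom : ∀ {a c b} (W : WalkIn R Q c b) → Unique (c ∷ visited W) → a ∈ c ∷ visited W
               → Σ (WalkIn R Q a b) λ W → Unique (a ∷ visited W)
    suffixFrom W            unique       (here refl) = W , unique
    suffixFrom (step r q W) (_ ∷ unique) (there a∈)  = suffixFrom W unique a∈

  erase : ∀ {a b} → WalkIn R Q a b → Σ (WalkIn R Q a b) λ W → Unique (a ∷ visited W)
  erase here = here , ([] ∷ [])
  erase (step {a} {c} r q W) with erase W
  ... | W′ , unique with a ∈? (c ∷ visited W′)
  ...   | yes a∈ = suffixFrom W′ unique a∈
  ...   | no a∉  = step r q W′ , (¬Any⇒All¬ _ a∉ ∷ unique)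

module _ {n : ℕ} where

  mapWalk : ∀ {R R′ : Fin n → Fin n → Bool} {Q Q′ : Fin n → Set}
          → (∀ {x y} → R x y ≡ true → R′ x y ≡ true) → (∀ {y} → Q y → Q′ y)
          → ∀ {a b} → WalkIn R Q a b → WalkIn R′ Q′ a b
  mapWalk R⇒R′ Q⇒Q′ here         = here
  mapWalk R⇒R′ Q⇒Q′ (step r q W) = step (R⇒R′ r) (Q⇒Q′ q) (mapWalk R⇒R′ Q⇒Q′ W)

  visited-mapWalk : ∀ {R R′ : Fin n → Fin n → Bool} {Q Q′ : Fin n → Set}
                    (R⇒R′ : ∀ {x y} → R x y ≡ true → R′ x y ≡ true) (Q⇒Q′ : ∀ {y} → Q y → Q′ y)
                  → ∀ {a b} (W : WalkIn R Q a b) → visited (mapWalk R⇒R′ Q⇒Q′ W) ≡ visited W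
  visited-mapWalk R⇒R′ Q⇒Q′ here         = refl
  visited-mapWalk R⇒R′ Q⇒Q′ (step r q W) = cong (_ ∷_) (visited-mapWalk R⇒R′ Q⇒Q′ W)

  reverse : ∀ {R : Fin n → Fin n → Bool} → (∀ {x y} → R x y ≡ true → R y x ≡ true)
          → ∀ {a b} → WalkIn R (λ _ → ⊤) a b → WalkIn R (λ _ → ⊤) b a
  reverse R-sym here         = here
  reverse R-sym (step r _ W) = snoc (reverse R-sym W) (R-sym r) tt

-- Cycles through a sequence of vertices

does⇒ : ∀ {A : Set} (A? : Dec A) → does A? ≡ true → A
does⇒ (yes a) _ = a

module CycleThrough {n : ℕ} (G : Graph n) (x : ℕ → Fin n) (m : ℕ) (2≤m : 2 ≤ m)
  (x-injective : ∀ {i j} → i ≤ m → j ≤ m → x i ≡ x j → i ≡ j)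
  (x-step : ∀ {i} → i < m → adj G (x i) (x (suc i)) ≡ true)
  (x-close : adj G (x m) (x 0) ≡ true) where

  next : ℕ → ℕ
  next i with i ℕ.≟ m
  ... | yes _ = 0
  ... | no _  = suc i

  prev : ℕ → ℕ
  prev zero    = m
  prev (suc i) = i

  next-m : next m ≡ 0
  next-m with m ℕ.≟ m
  ... | yes _  = refl
  ... | no m≢m = ⊥-elim (m≢m refl)

  next-< : ∀ {i} → i < m → next i ≡ suc i
  next-< {i} i<m with i ℕ.≟ m
  ... | yes refl = ⊥-elim (<-irrefl refl i<m)
  ... | no _     = refl

  next-≤ : ∀ {i} → i ≤ m → next i ≤ m
  next-≤ i≤m with m≤n⇒m<n∨m≡n i≤m
  ... | inj₁ i<m  rewrite next-< i<m = i<m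
  ... | inj₂ refl rewrite next-m     = z≤n

  prev-≤ : ∀ {i} → i ≤ m → prev i ≤ m
  prev-≤ {zero}  _        = ≤-refl
  prev-≤ {suc i} 1+i≤m = ≤-trans (n≤1+n i) 1+i≤m

  next∘prev : ∀ {i} → i ≤ m → next (prev i) ≡ i
  next∘prev {zero}  _     = next-m
  next∘prev {suc i} 1+i≤m = next-< 1+i≤m

  prev∘next : ∀ {i} → i ≤ m → prev (next i) ≡ i
  prev∘next i≤m with m≤n⇒m<n∨m≡n i≤m
  ... | inj₁ i<m  rewrite next-< i<m = refl
  ... | inj₂ refl rewrite next-m     = refl

  next≢prev : ∀ {i} → i ≤ m → next i ≢ prev i
  next≢prev {zero} _ rewrite next-< (≤-trans (s≤s z≤n) 2≤m) = λ 1≡m → <-irrefl 1≡m 2≤m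
  next≢prev {suc i} 1+i≤m with m≤n⇒m<n∨m≡n 1+i≤m
  ... | inj₁ 1+i<m rewrite next-< 1+i<m = λ ()
  ... | inj₂ 1+i≡m = λ next≡i → <-irrefl (1≡m next≡i) 2≤m
    where
    1≡m : next (suc i) ≡ i → 1 ≡ m
    1≡m e = trans (cong suc (trans (sym (trans (cong next 1+i≡m) next-m)) e)) 1+i≡m

  x-next : ∀ {i} → i ≤ m → adj G (x i) (x (next i)) ≡ true
  x-next i≤m with m≤n⇒m<n∨m≡n i≤m
  ... | inj₁ i<m  rewrite next-< i<m = x-step i<m
  ... | inj₂ refl rewrite next-m     = x-close

  EdgeAt : ℕ → Fin n → Fin n → Set
  EdgeAt j a b = (x j ≡ a × x (next j) ≡ b) ⊎ (x j ≡ b × x (next j) ≡ a)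

  edgeAt? : ∀ a b j → Dec (EdgeAt j a b)
  edgeAt? a b j = ((x j ≟ a) ×-dec (x (next j) ≟ b)) ⊎-dec ((x j ≟ b) ×-dec (x (next j) ≟ a))

  cycle : Fin n → Fin n → Bool
  cycle a b = does (anyUpTo? (edgeAt? a b) (suc m))

  cycle-true⇒ : ∀ {a b} → cycle a b ≡ true → ∃ λ j → j ≤ m × EdgeAt j a b
  cycle-true⇒ {a} {b} e with j , s≤s j≤m , E ← does⇒ (anyUpTo? (edgeAt? a b) (suc m)) e = j , j≤m , E

  ⇒cycle-true : ∀ {a b j} → j ≤ m → EdgeAt j a b → cycle a b ≡ true
  ⇒cycle-true {a} {b} {j} j≤m E = dec-true (anyUpTo? (edgeAt? a b) (suc m)) (j , s≤s j≤m , E)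

  cycle-sym : ∀ a b → cycle a b ≡ cycle b a
  cycle-sym a b = does-⇔ (mk⇔ flip flip) (anyUpTo? (edgeAt? a b) (suc m)) (anyUpTo? (edgeAt? b a) (suc m))
    where
    flip : ∀ {c d} → ∃ (λ j → j < suc m × EdgeAt j c d) → ∃ (λ j → j < suc m × EdgeAt j d c)
    flip (j , j< , E) = j , j< , swap E

  cycle⇒adj : ∀ a b → cycle a b ≡ true → adj G a b ≡ true
  cycle⇒adj a b e with cycle-true⇒ e
  ... | j , j≤m , inj₁ (refl , refl) = x-next j≤m
  ... | j , j≤m , inj₂ (refl , refl) = trans (Graph.sym G _ _) (x-next j≤m)

  cycle-next : ∀ {i} → i ≤ m → cycle (x i) (x (next i)) ≡ true
  cycle-next i≤m = ⇒cycle-true i≤m (inj₁ (refl , refl))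

  cycle-prev : ∀ {i} → i ≤ m → cycle (x i) (x (prev i)) ≡ true
  cycle-prev {i} i≤m = ⇒cycle-true (prev-≤ i≤m) (inj₂ (refl , cong x (next∘prev i≤m)))

  cycle-nbr : ∀ {i y} → i ≤ m → cycle (x i) y ≡ true → y ≡ x (next i) ⊎ y ≡ x (prev i)
  cycle-nbr {i} i≤m e with cycle-true⇒ e
  ... | j , j≤m , inj₁ (xj≡xi , refl) with refl ← x-injective j≤m i≤m xj≡xi = inj₁ refl
  ... | j , j≤m , inj₂ (refl , xnj≡xi) =
    inj₂ (cong x (trans (sym (prev∘next j≤m)) (cong prev (x-injective (next-≤ j≤m) i≤m xnj≡xi))))

  countNbrs-on : ∀ {i} → i ≤ m → countNbrs cycle (x i) ≡ 2
  countNbrs-on {i} i≤m = countNbrs≡length {R = cycle} {a = x i} {ys = x (next i) ∷ x (prev i) ∷ []}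
    (((λ e → next≢prev i≤m (x-injective (next-≤ i≤m) (prev-≤ i≤m) e)) ∷ []) ∷ [] ∷ [])
    (λ e → nbr∈ (cycle-nbr i≤m e))
    (λ { (here refl) → cycle-next i≤m ; (there (here refl)) → cycle-prev i≤m })
    where
    nbr∈ : ∀ {y} → y ≡ x (next i) ⊎ y ≡ x (prev i) → y ∈ x (next i) ∷ x (prev i) ∷ []
    nbr∈ (inj₁ refl) = here refl
    nbr∈ (inj₂ refl) = there (here refl)

  on-or-off : ∀ u → (∃ λ i → i ≤ m × x i ≡ u) ⊎ (∀ y → cycle u y ≡ false)
  on-or-off u with anyUpTo? (λ i → x i ≟ u) (suc m)
  ... | yes (i , s≤s i≤m , refl) = inj₁ (i , i≤m , refl)
  ... | no off = inj₂ λ y → dec-false (anyUpTo? (edgeAt? u y) (suc m)) λ where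
    (j , j< , inj₁ (refl , _)) → off (j , j< , refl)
    (j , s≤s j≤m , inj₂ (_ , refl)) → off (next j , s≤s (next-≤ j≤m) , refl)

  countNbrs-off : ∀ {u} → (∀ y → cycle u y ≡ false) → countNbrs cycle u ≡ 0
  countNbrs-off {u} off = countNbrs≡length {R = cycle} {a = u} {ys = []} []
    (λ {y} e → ⊥-elim (false≢true (trans (sym (off y)) e))) λ ()
    where
    false≢true : false ≢ true
    false≢true ()

  toStart : ∀ i → i ≤ m → WalkIn cycle (λ _ → ⊤) (x i) (x 0)
  toStart zero    _     = here
  toStart (suc i) 1+i≤m = step (trans (cycle-sym _ _) (subst (λ j → cycle (x i) (x j) ≡ true) (next-< 1+i≤m)
                                 (cycle-next (<⇒≤ 1+i≤m))))
                               tt (toStart i (<⇒≤ 1+i≤m))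

  isCycle : IsCycle G cycle
  isCycle = cycle⇒adj , cycle-sym , (x 0 , x (next 0) , cycle-next z≤n) , counts , connected
    where
    counts : ∀ u → countNbrs cycle u ≡ 0 ⊎ countNbrs cycle u ≡ 2
    counts u with on-or-off u
    ... | inj₁ (i , i≤m , refl) = inj₂ (countNbrs-on i≤m)
    ... | inj₂ off              = inj₁ (countNbrs-off off)
    on : ∀ u → countNbrs cycle u ≡ 2 → ∃ λ i → i ≤ m × x i ≡ u
    on u two with on-or-off u
    ... | inj₁ on-u = on-u
    ... | inj₂ off  with () ← trans (sym (countNbrs-off off)) two
    connected : ∀ a b → countNbrs cycle a ≡ 2 → countNbrs cycle b ≡ 2 → WalkIn cycle (λ _ → ⊤) a b
    connected a b a-on b-on with on a a-on | on b b-on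
    ... | i , i≤m , refl | j , j≤m , refl =
      toStart i i≤m ++ʷ reverse (λ {c} {d} e → trans (cycle-sym d c) e) (toStart j j≤m)

  cycle-close : cycle (x m) (x 0) ≡ true
  cycle-close = subst (λ j → cycle (x m) (x j) ≡ true) next-m (cycle-next ≤-refl)

simpleClosedWalk⇒cycle : ∀ {n} (G : Graph n) {Q : Fin n → Set} {a b} (W : WalkIn (adj G) Q a b)
                       → Unique (a ∷ visited W) → 2 ≤ length (visited W) → adj G b a ≡ true
                       → Σ (Fin n → Fin n → Bool) λ C′ → IsCycle G C′ × C′ b a ≡ true
simpleClosedWalk⇒cycle G {a = a} W unique 2≤len Gba =
  C.cycle , C.isCycle , subst (λ c → C.cycle c a ≡ true) (vertexAt-end W) C.cycle-close
  where
  closing : adj G (vertexAt W (length (visited W))) a ≡ true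
  closing = subst (λ c → adj G c a ≡ true) (sym (vertexAt-end W)) Gba
  module C = CycleThrough G (vertexAt W) (length (visited W)) 2≤len
                          (vertexAt-injective W unique) (vertexAt-step W) closing

-- The pendant tree T_v of a unicyclic graph

module PendantTree {n : ℕ} (G : Graph n) (C : Fin n → Fin n → Bool) (v : Fin n)
  (unicyclic : UnicyclicWith G C) (v-on-C : CycleVertex C v) where

  C-isCycle : IsCycle G C
  C-isCycle = proj₁ (proj₂ unicyclic)

  C⊆G : ∀ a b → C a b ≡ true → adj G a b ≡ true
  C⊆G = proj₁ C-isCycle

  C-sym : ∀ a b → C a b ≡ C b a
  C-sym = proj₁ (proj₂ C-isCycle)

  private
    C-degree : ∀ u → countNbrs C u ≡ 0 ⊎ countNbrs C u ≡ 2
    C-degree = proj₁ (proj₂ (proj₂ (proj₂ C-isCycle)))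

    C-connected : ∀ a b → CycleVertex C a → CycleVertex C b → WalkIn C (λ _ → ⊤) a b
    C-connected = proj₂ (proj₂ (proj₂ (proj₂ C-isCycle)))

    C-unique : ∀ C′ → IsCycle G C′ → ∀ a b → C′ a b ≡ C a b
    C-unique = proj₂ (proj₂ unicyclic)

  Tᵥ : Fin n → Set
  Tᵥ = InPendant G C v

  OffCycle : Fin n → Set
  OffCycle u = ¬ CycleVertex C u

  onCycle? : ∀ u → Dec (CycleVertex C u)
  onCycle? u = countNbrs C u ℕ.≟ 2

  C⇒onCycle : ∀ {a b} → C a b ≡ true → CycleVertex C a
  C⇒onCycle {a} Cab with C-degree a
  ... | inj₂ two  = two
  ... | inj₁ none with () ← subst (0 <_) none (0<countNbrs {R = C} {a = a} Cab)

  Tᵥ⇒offCycle : ∀ {u} → Tᵥ u → u ≢ v → OffCycle u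
  Tᵥ⇒offCycle Tu u≢v with end-in-Q Tu
  ... | inj₁ v≡u = ⊥-elim (u≢v (sym v≡u))
  ... | inj₂ off = off

  closingEdge∈C : ∀ {u w} (W : WalkIn (adj G) (λ _ → ⊤) w u) → Unique (w ∷ visited W)
                → 2 ≤ length (visited W) → adj G u w ≡ true → C u w ≡ true
  closingEdge∈C W simple 2≤len Guw
    with C′ , C′-isCycle , C′uw ← simpleClosedWalk⇒cycle G W simple 2≤len Guw
    = trans (sym (C-unique C′ C′-isCycle _ _)) C′uw

  -- The walk w ⇝ v along C, then v ⇝ u inside T_v, closed by the edge u w, is a simple closed
  -- walk, so by uniqueness of the cycle its closing edge lies on C.  When it is too short to be
  -- a cycle (u = v and w is a C-neighbour of v) the claim holds directly.
  private
    closeUp : ∀ {u w} → CycleVertex C w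
            → (W₁ : WalkIn (adj G) OffCycle v u) → Unique (v ∷ visited W₁)
            → (W₂ : WalkIn C (λ _ → ⊤) w v) → Unique (w ∷ visited W₂)
            → 2 ≤ length (visited W₂) + length (visited W₁) → adj G u w ≡ true → C u w ≡ true
    closeUp {w = w} w-on W₁ (_ ∷ simple₁) W₂ simple₂ 2≤len Guw =
      closingEdge∈C W (subst (λ xs → Unique (w ∷ xs)) (sym visited-W) simple)
                    (subst (2 ≤_) (sym (trans (cong length visited-W) (length-++ (visited W₂)))) 2≤len) Guw
      where
      W : WalkIn (adj G) (λ _ → ⊤) w _
      W = mapWalk (C⊆G _ _) _ W₂ ++ʷ mapWalk id _ W₁
      visited-W : visited W ≡ visited W₂ ++ visited W₁
      visited-W = trans (visited-++ʷ (mapWalk (C⊆G _ _) _ W₂) (mapWalk id _ W₁))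
                        (cong₂ _++_ (visited-mapWalk (C⊆G _ _) _ W₂) (visited-mapWalk id _ W₁))
      on₂ : All (CycleVertex C) (w ∷ visited W₂)
      on₂ = w-on ∷ All-visited (λ {x} {y} Cxy _ → C⇒onCycle (trans (C-sym y x) Cxy)) W₂
      off₁ : All OffCycle (visited W₁)
      off₁ = All-visited (λ _ off → off) W₁
      simple : Unique (w ∷ visited W₂ ++ visited W₁)
      simple = Unique.++⁺ simple₂ simple₁ (λ (x∈₂ , x∈₁) → All.lookup off₁ x∈₁ (All.lookup on₂ x∈₂))

    closeUp-cases : ∀ {u w} → CycleVertex C w → w ≢ v → adj G u w ≡ true
                  → (W₁ : WalkIn (adj G) OffCycle v u) → Unique (v ∷ visited W₁)
                  → (W₂ : WalkIn C (λ _ → ⊤) w v) → Unique (w ∷ visited W₂) → C u w ≡ true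
    closeUp-cases _    w≢v _   here _ here _ = ⊥-elim (w≢v refl)
    closeUp-cases _    _   _   here _ (step Cwv _ here) _ = trans (C-sym _ _) Cwv
    closeUp-cases w-on _   Guw here s₁ W₂@(step _ _ (step _ _ _)) s₂ =
      closeUp w-on here s₁ W₂ s₂ (s≤s (s≤s z≤n)) Guw
    closeUp-cases _    w≢v _   (step _ _ _) _ here _ = ⊥-elim (w≢v refl)
    closeUp-cases w-on _   Guw W₁@(step _ _ _) s₁ W₂@(step _ _ _) s₂ =
      closeUp w-on W₁ s₁ W₂ s₂ (+-mono-≤ (s≤s z≤n) (s≤s z≤n)) Guw

  Tᵥ-edge-to-cycle⇒C : ∀ {u w} → Tᵥ u → adj G u w ≡ true → CycleVertex C w → w ≢ v → C u w ≡ true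
  Tᵥ-edge-to-cycle⇒C {w = w} Tu Guw w-on w≢v
    with W₁ , s₁ ← erase Tu | W₂ , s₂ ← erase (C-connected w v w-on v-on-C)
    = closeUp-cases w-on w≢v Guw W₁ s₁ W₂ s₂

  Tᵥ-closed : ∀ {u w} → Tᵥ u → u ≢ v → adj G u w ≡ true → Tᵥ w
  Tᵥ-closed {u} {w} Tu u≢v Guw with w ≟ v | onCycle? w
  ... | yes refl | _        = here
  ... | no w≢v   | yes w-on = ⊥-elim (Tᵥ⇒offCycle Tu u≢v (C⇒onCycle (Tᵥ-edge-to-cycle⇒C Tu Guw w-on w≢v)))
  ... | no _     | no off   = snoc Tu Guw off

  Tᵥ?-at-root-nbr : ∀ {w} → adj G v w ≡ true → Dec (Tᵥ w)
  Tᵥ?-at-root-nbr {w} Gvw with onCycle? w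
  ... | yes w-on = no λ Tw → Tᵥ⇒offCycle Tw (λ w≡v → adj⇒≢ G Gvw (sym w≡v)) w-on
  ... | no off   = yes (step Gvw off here)

  root-nbr-outside-Tᵥ⇒C : ∀ {w} → adj G v w ≡ true → ¬ Tᵥ w → C v w ≡ true
  root-nbr-outside-Tᵥ⇒C {w} Gvw ¬Tw with onCycle? w
  ... | yes w-on = Tᵥ-edge-to-cycle⇒C here Gvw w-on (λ w≡v → adj⇒≢ G Gvw (sym w≡v))
  ... | no off   = ⊥-elim (¬Tw (step Gvw off here))

  data Near : ℕ → Fin n → Set where
    root : ∀ {k} → Near k v
    grow : ∀ {k c u} → Near k c → adj G c u ≡ true → OffCycle u → Near (suc k) u

  near? : ∀ k u → Dec (Near k u)
  near? zero u with u ≟ v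
  ... | yes refl = yes root
  ... | no u≢v   = no λ { root → u≢v refl }
  near? (suc k) u with u ≟ v
  ... | yes refl = yes root
  ... | no u≢v   = map′ (λ (_ , Nc , Gcu , off) → grow Nc Gcu off) inward
                        (any? λ c → near? k c ×-dec (adj G c u ≟ᵇ true) ×-dec ¬? (onCycle? u))
    where
    inward : Near (suc k) u → ∃ λ c → Near k c × adj G c u ≡ true × OffCycle u
    inward root              = ⊥-elim (u≢v refl)
    inward (grow Nc Gcu off) = _ , Nc , Gcu , off

  near-≤ : ∀ {j k u} → j ≤ k → Near j u → Near k u
  near-≤ _         root             = root
  near-≤ (s≤s j≤k) (grow Nc Gcu off) = grow (near-≤ j≤k Nc) Gcu off

  near⇒Tᵥ : ∀ {k u} → Near k u → Tᵥ u
  near⇒Tᵥ root              = here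
  near⇒Tᵥ (grow Nc Gcu off) = snoc (near⇒Tᵥ Nc) Gcu off

  Tᵥ⇒near : ∀ {u} → Tᵥ u → ∃ λ k → Near k u
  Tᵥ⇒near = extend (root {0})
    where
    extend : ∀ {k a b} → Near k a → WalkIn (adj G) OffCycle a b → ∃ λ k → Near k b
    extend Na here         = _ , Na
    extend Na (step r q W) = extend (grow Na r q) W

  record Parent (u : Fin n) : Set where
    field
      vertex : Fin n
      level  : ℕ
      near   : Near level vertex
      edge   : adj G vertex u ≡ true
      far    : ¬ Near level u

  parentOf : ∀ k {u} → Near k u → u ≢ v → Parent u
  parentOf _       root                       u≢v = ⊥-elim (u≢v refl)
  parentOf (suc k) {u} (grow {c = c} Nc Gcu _) u≢v with near? k u
  ... | yes Nu = parentOf k Nu u≢v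
  ... | no ¬Nu = record { vertex = c ; level = k ; near = Nc ; edge = Gcu ; far = ¬Nu }

  parent : ∀ {u} → Tᵥ u → u ≢ v → Parent u
  parent Tu = parentOf _ (proj₂ (Tᵥ⇒near Tu))

  no-mutual-parents : ∀ {u u′} (p : Parent u) (p′ : Parent u′)
                    → Parent.vertex p ≡ u′ → Parent.vertex p′ ≡ u → ⊥
  no-mutual-parents p p′ refl refl with ≤-total (Parent.level p) (Parent.level p′)
  ... | inj₁ l≤l′ = Parent.far p′ (near-≤ l≤l′ (Parent.near p))
  ... | inj₂ l′≤l = Parent.far p (near-≤ l′≤l (Parent.near p′))

  parentEdge : ∀ {u} → Tᵥ u → u ≢ v → Fin n × Fin n
  parentEdge {u} Tu u≢v = edgeOf u (Parent.vertex (parent Tu u≢v))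

  parentEdge-∈ : ∀ {u} (Tu : Tᵥ u) (u≢v : u ≢ v) → parentEdge Tu u≢v ∈ edges G
  parentEdge-∈ Tu u≢v = edgeOf-∈ G (trans (Graph.sym G _ _) (Parent.edge (parent Tu u≢v)))

  parentEdge-Tᵥ : ∀ {u a b} (Tu : Tᵥ u) (u≢v : u ≢ v) → parentEdge Tu u≢v ≡ (a , b) → Tᵥ a × Tᵥ b
  parentEdge-Tᵥ Tu u≢v e with edgeOf-endpoints e
  ... | inj₁ (refl , refl) = Tu , near⇒Tᵥ (Parent.near (parent Tu u≢v))
  ... | inj₂ (refl , refl) = near⇒Tᵥ (Parent.near (parent Tu u≢v)) , Tu

  parentEdge-injective : ∀ {u u′} (Tu : Tᵥ u) (u≢v : u ≢ v) (Tu′ : Tᵥ u′) (u′≢v : u′ ≢ v)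
                       → parentEdge Tu u≢v ≡ parentEdge Tu′ u′≢v → u ≡ u′
  parentEdge-injective Tu u≢v Tu′ u′≢v e with edgeOf-injective e
  ... | inj₁ (u≡u′ , _)   = u≡u′
  ... | inj₂ (u≡p′ , p≡u′) = ⊥-elim (no-mutual-parents (parent Tu u≢v) (parent Tu′ u′≢v) p≡u′ (sym u≡p′))

-- Edges of the star transform

module StarTransform {n : ℕ} (G : Graph n) (C : Fin n → Fin n → Bool) (v : Fin n)
  (unicyclic : UnicyclicWith G C) (local-max : LocalMax G C v)
  (G′ : Graph n) (transform : IsStarTransform G C v G′) where

  open PendantTree G C v unicyclic (proj₁ local-max)

  G′-star-edge : ∀ {u} → Tᵥ u → u ≢ v → adj G′ v u ≡ true
  G′-star-edge Tu u≢v =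
    Equivalence.from (transform v _) (inj₁ (here , Tu , inj₁ refl , λ v≡u → u≢v (sym v≡u)))

  G′-kept-edge : ∀ {a b} → ¬ (Tᵥ a × Tᵥ b) → adj G a b ≡ true → adj G′ a b ≡ true
  G′-kept-edge ¬both Gab = Equivalence.from (transform _ _) (inj₂ (¬both , Gab))

  D : ℕ
  D = deg G′ v

  deg-leaf : ∀ {u} → Tᵥ u → u ≢ v → deg G′ u ≡ 1
  deg-leaf {u} Tu u≢v = countNbrs≡length {R = adj G′} {a = u} ([] ∷ []) only-v (λ { (here refl) → G′uv })
    where
    G′uv : adj G′ u v ≡ true
    G′uv = Equivalence.from (transform u v) (inj₁ (Tu , here , inj₂ refl , u≢v))
    only-v : ∀ {w} → adj G′ u w ≡ true → w ∈ v ∷ []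
    only-v {w} G′uw with Equivalence.to (transform u w) G′uw
    ... | inj₁ (_ , _ , inj₁ u≡v , _) = ⊥-elim (u≢v u≡v)
    ... | inj₁ (_ , _ , inj₂ w≡v , _) = here w≡v
    ... | inj₂ (¬both , Guw)           = ⊥-elim (¬both (Tu , Tᵥ-closed Tu u≢v Guw))

  deg-outside : ∀ {x} → ¬ Tᵥ x → deg G′ x ≡ deg G x
  deg-outside {x} ¬Tx = countNbrs≡length {R = adj G′} {a = x} (nbrs-unique {R = adj G} {a = x}) to
    (λ w∈ → G′-kept-edge (λ (Tx , _) → ¬Tx Tx) (∈-nbrs⁻ {R = adj G} {a = x} w∈))
    where
    to : ∀ {w} → adj G′ x w ≡ true → w ∈ nbrs (adj G) x
    to {w} G′xw with Equivalence.to (transform x w) G′xw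
    ... | inj₁ (Tx , _) = ⊥-elim (¬Tx Tx)
    ... | inj₂ (_ , Gxw) = ∈-nbrs⁺ {R = adj G} {a = x} Gxw

  deg-root≤ : deg G v ≤ D
  deg-root≤ = countNbrs-≤ {R = adj G} {a = v} {S = adj G′} {b = v} id root-edge
    where
    root-edge : ∀ {w} → adj G v w ≡ true → adj G′ v w ≡ true
    root-edge {w} Gvw with Tᵥ?-at-root-nbr Gvw
    ... | yes Tw = G′-star-edge Tw (λ w≡v → adj⇒≢ G Gvw (sym w≡v))
    ... | no ¬Tw = G′-kept-edge (λ (_ , Tw) → ¬Tw Tw) Gvw

  -- Swapping v with a cycle neighbour c of v maps the neighbours of u injectively
  -- into those of v in G′.
  deg-Tᵥ≤ : ∀ {u} → Tᵥ u → deg G u ≤ D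
  deg-Tᵥ≤ {u} Tu with u ≟ v
  ... | yes refl = deg-root≤
  ... | no u≢v with c , Cvc ← nbr-witness {R = C} {a = v} (subst (0 <_) (sym (proj₁ local-max)) (s≤s z≤n)) =
    countNbrs-≤ {R = adj G} {a = u} {S = adj G′} {b = v} (transpose-injective v c) swapped
    where
    c-on : CycleVertex C c
    c-on = C⇒onCycle (trans (C-sym c v) Cvc)
    Gvc : adj G v c ≡ true
    Gvc = C⊆G v c Cvc
    swapped : ∀ {w} → adj G u w ≡ true → adj G′ v (transpose v c w) ≡ true
    swapped {w} Guw = by-cases (w ≟ v)
      where
      by-cases : Dec (w ≡ v) → adj G′ v (transpose v c w) ≡ true
      by-cases (yes refl) = subst (λ z → adj G′ v z ≡ true) (sym (transpose-≡ v c))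
        (G′-kept-edge (λ (_ , Tc) → Tᵥ⇒offCycle Tc (λ c≡v → adj⇒≢ G Gvc (sym c≡v)) c-on) Gvc)
      by-cases (no w≢v) = subst (λ z → adj G′ v z ≡ true) (sym (transpose-≢ w≢v w≢c)) (G′-star-edge Tw w≢v)
        where
        Tw = Tᵥ-closed Tu u≢v Guw
        w≢c : w ≢ c
        w≢c refl = Tᵥ⇒offCycle Tw w≢v c-on

  data G′-EdgeKind (a b : Fin n) : Set where
    star : ∀ {u} (Tu : Tᵥ u) (u≢v : u ≢ v) → (a , b) ≡ edgeOf v u → G′-EdgeKind a b
    kept : ¬ (Tᵥ a × Tᵥ b) → adj G a b ≡ true → G′-EdgeKind a b

  classify : ∀ {a b} → adj G′ a b ≡ true → toℕ a < toℕ b → G′-EdgeKind a b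
  classify {a} {b} G′ab a<b with Equivalence.to (transform a b) G′ab
  ... | inj₁ (_ , Tb , inj₁ refl , a≢b) = star Tb (λ b≡a → a≢b (sym b≡a)) (sym (edgeOf-< a<b))
  ... | inj₁ (Ta , _ , inj₂ refl , a≢b) = star Ta a≢b (sym (edgeOf-> a<b))
  ... | inj₂ (¬both , Gab)              = kept ¬both Gab

  image : ∀ {a b} → G′-EdgeKind a b → Fin n × Fin n
  image (star Tu u≢v _) = parentEdge Tu u≢v
  image {a} {b} (kept _ _) = a , b

  image-∈ : ∀ {a b} (k : G′-EdgeKind a b) → toℕ a < toℕ b → image k ∈ edges G
  image-∈ (star Tu u≢v _) _   = parentEdge-∈ Tu u≢v
  image-∈ (kept _ Gab)     a<b = ∈-edges⁺ G Gab a<b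

  image-injective : ∀ {a b a′ b′} (k : G′-EdgeKind a b) (k′ : G′-EdgeKind a′ b′)
                  → image k ≡ image k′ → (a , b) ≡ (a′ , b′)
  image-injective (star Tu u≢v e) (star Tu′ u′≢v e′) same
    with refl ← parentEdge-injective Tu u≢v Tu′ u′≢v same = trans e (sym e′)
  image-injective (star Tu u≢v _) (kept ¬both _) same = ⊥-elim (¬both (parentEdge-Tᵥ Tu u≢v same))
  image-injective (kept ¬both _) (star Tu u≢v _) same = ⊥-elim (¬both (parentEdge-Tᵥ Tu u≢v (sym same)))
  image-injective (kept _ _)     (kept _ _)     same = same

  module _ (N : ℕ) where

    root-edge-dominated : ∀ {w} → adj G v w ≡ true → ¬ Tᵥ w
                        → lowerTerm N D (deg G′ w) ≤q upperTerm N (deg G v) (deg G w)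
    root-edge-dominated {w} Gvw ¬Tw rewrite deg-outside ¬Tw =
      lowerTerm≤upperTerm N D (deg G w) (deg G v) (deg G w) (0<deg+deg G Gvw)
        (grow≤ʷ (proj₂ local-max w (root-nbr-outside-Tᵥ⇒C Gvw ¬Tw)) deg-root≤)

    kept-edge-dominated : ∀ {a b} → ¬ (Tᵥ a × Tᵥ b) → adj G a b ≡ true
                        → lowerTerm N (deg G′ a) (deg G′ b) ≤q upperTerm N (deg G a) (deg G b)
    kept-edge-dominated {a} {b} ¬both Gab with a ≟ v | b ≟ v
    ... | yes refl | _        = root-edge-dominated Gab (λ Tb → ¬both (here , Tb))
    ... | no _     | yes refl =
      subst₂ _≤q_ (lowerTerm-comm N D (deg G′ a)) (upperTerm-comm N (deg G v) (deg G a))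
        (root-edge-dominated (trans (Graph.sym G v a) Gab) (λ Ta → ¬both (Ta , here)))
    ... | no a≢v   | no b≢v   =
      subst₂ (λ x y → lowerTerm N x y ≤q upperTerm N (deg G a) (deg G b))
        (sym (deg-outside ¬Ta)) (sym (deg-outside ¬Tb))
        (lowerTerm≤upperTerm N (deg G a) (deg G b) (deg G a) (deg G b) (0<deg+deg G Gab) ≤-refl)
      where
      ¬Ta : ¬ Tᵥ a
      ¬Ta Ta = ¬both (Ta , Tᵥ-closed Ta a≢v Gab)
      ¬Tb : ¬ Tᵥ b
      ¬Tb Tb = ¬both (Tᵥ-closed Tb b≢v (trans (Graph.sym G b a) Gab) , Tb)

    image-dominates : ∀ {a b} (k : G′-EdgeKind a b) → lowerTermOf N G′ (a , b) ≤q upperTermOf N G (image k)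
    image-dominates (kept ¬both Gab) = kept-edge-dominated ¬both Gab
    image-dominates {a} {b} (star {u} Tu u≢v e) = begin
      lowerTermOf N G′ (a , b)             ≡⟨ cong (lowerTermOf N G′) e ⟩
      lowerTermOf N G′ (edgeOf v u)        ≡⟨ lowerTermOf-edgeOf N G′ v u ⟩
      lowerTerm N D (deg G′ u)             ≡⟨ cong (lowerTerm N D) (deg-leaf Tu u≢v) ⟩
      lowerTerm N D 1                      ≤⟨ lowerTerm≤upperTerm N D 1 (deg G u) (deg G p) (0<deg+deg G Gup) weight ⟩
      upperTerm N (deg G u) (deg G p)      ≡⟨ upperTermOf-edgeOf N G u p ⟨
      upperTermOf N G (parentEdge Tu u≢v)  ∎
      where
      open ℚᵘ.≤-Reasoning
      p = Parent.vertex (parent Tu u≢v)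
      Tp = near⇒Tᵥ (Parent.near (parent Tu u≢v))
      Gpu = Parent.edge (parent Tu u≢v)
      Gup = trans (Graph.sym G u p) Gpu
      weight : (D , 1) ≤ʷ (deg G u , deg G p)
      weight = star≤ʷ (0<deg G Gup) (0<deg G Gpu) (deg-Tᵥ≤ Tu) (deg-Tᵥ≤ Tp)

  edgeKind : ∀ {e} → e ∈ edges G′ → G′-EdgeKind (proj₁ e) (proj₂ e)
  edgeKind e∈ = classify (proj₁ (∈-edges⁻ G′ e∈)) (proj₂ (∈-edges⁻ G′ e∈))

mainTheorem3 : (n : ℕ) (G : Graph n) (C : Fin n → Fin n → Bool) (v : Fin n)
    → UnicyclicWith G C → LocalMax G C v
    → (G' : Graph n) → IsStarTransform G C v G'
    → GA≤ G' G
mainTheorem3 n G C v unicyclic local-max G′ transform N =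
  sumQ-≤-injection (lowerTermOf N G′) (upperTermOf N G) (λ (a , b) → 0≤upperTerm N (deg G a) (deg G b))
    (edges-unique G′)
    (λ e∈ → image (edgeKind e∈))
    (λ e∈ → image-∈ (edgeKind e∈) (proj₂ (∈-edges⁻ G′ e∈)))
    (λ e∈ e′∈ → image-injective (edgeKind e∈) (edgeKind e′∈))
    (λ e∈ → image-dominates N (edgeKind e∈))
  where open StarTransform G C v unicyclic local-max G′ transform
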